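{- Let $\mathbb{N}=\{1,2,\ldots\}$. There is a function $f:\mathbb{N}^2\to\mathbb{N}^2$ that can be evaluated in constant time and has the following properties: for all $a,b\in\mathbb{N}$, if $(a',b')=f(a,b)$, then (i) $a'\mid b'$ or $b'\mid a'$; (ii) $a/2<a'\le a$; (iii) $\max\{b/2,\,b-\sqrt{b}\}<b'\le b$; (iv) $(a-b)(a'-b')\ge 0$.
   Context: "Evaluated in constant time" refers to a constant number of elementary arithmetic operations (e.g., integer division, floor, ceiling, comparisons) on the arguments. -}

module Defs where

open import Data.Nat using (ℕ; zero; suc; _+_; _*_; _∸_; _≤_; _<_; _/_; _≤ᵇ_)
open import Data.Bool using (if_then_else_)
open import Data.Product using (_×_; _,_; Σ)
open import Relation.Binary.PropositionalEquality using (_≡_)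

_÷_ : ℕ → ℕ → ℕ
m ÷ zero = 0
m ÷ suc n = m / suc n

-- A fixed (finite) expression uses a constant number of elementary
-- arithmetic operations, independent of the inputs.
data Expr : Set where
  varA varB : Expr
  const     : ℕ → Expr
  _⊕_ _⊖_ _⊗_ _⊘_ : Expr → Expr → Expr
  ifLe      : Expr → Expr → Expr → Expr → Expr

eval : Expr → ℕ → ℕ → ℕ
eval varA a b = a
eval varB a b = b
eval (const c) a b = c
eval (x ⊕ y) a b = eval x a b + eval y a b
eval (x ⊖ y) a b = eval x a b ∸ eval y a b
eval (x ⊗ y) a b = eval x a b * eval y a b
eval (x ⊘ y) a b = eval x a b ÷ eval y a b
eval (ifLe x y t e) a b = if eval x a b ≤ᵇ eval y a b then eval t a b else eval e a b

ConstantTime : (ℕ → ℕ → ℕ × ℕ) → Set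
ConstantTime f = Σ Expr λ e₁ → Σ Expr λ e₂ →
  ∀ a b → 1 ≤ a → 1 ≤ b → f a b ≡ (eval e₁ a b , eval e₂ a b)

open import Data.Nat.Divisibility using (_∣_)
open import Data.Integer using (+_; _-_; 0ℤ) renaming (_*_ to _*ℤ_; _≤_ to _≤ℤ_)
open import Data.Sum using (_⊎_)

-- Properties (i)–(iv) of an output pair (a′, b′) for input (a, b).
-- (ii)  a/2 < a′ ≤ a                     written  a < 2a′  and  a′ ≤ a
-- (iii) max{b/2, b − √b} < b′ ≤ b        written  b < 2b′, (b − b′)² < b, b′ ≤ b
--       (given b′ ≤ b:  b − √b < b′  ⇔  b − b′ < √b  ⇔  (b − b′)² < b)
-- (iv)  (a − b)(a′ − b′) ≥ 0  in ℤ
Props : ℕ → ℕ → ℕ → ℕ → Set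
Props a b a′ b′ =
  ((a′ ∣ b′) ⊎ (b′ ∣ a′))
  × (a < 2 * a′ × a′ ≤ a)
  × ((b < 2 * b′ × (b ∸ b′) * (b ∸ b′) < b) × b′ ≤ b)
  × (0ℤ ≤ℤ ((+ a - + b) *ℤ (+ a′ - + b′)))

module Submission where

open import Defs
open import Data.Nat using (ℕ; _≤_)
open import Data.Product using (_×_; Σ; proj₁; proj₂)

open import Data.Nat using (zero; suc; _+_; _*_; _∸_; _<_; _/_; _%_; _≤ᵇ_; z≤n; s≤s; s≤s⁻¹)
open import Data.Nat.Properties
open import Data.Nat.DivMod
  using (m≡m%n+[m/n]*n; m%n≡m∸m/n*n; m%n<n; m/n*n≤m; m≥n⇒m/n>0; m*n/n≡m; /-monoˡ-≤)
open import Data.Nat.Divisibility using (_∣_; m∣m*n; n∣m*n; ∣-refl)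
import Data.Nat.Tactic.RingSolver as ℕ-Ring
open import Data.Integer using (ℤ; +_; _-_; 0ℤ; +≤+) renaming (_*_ to _*ℤ_; _≤_ to _≤ℤ_)
import Data.Integer.Properties as ℤP
import Data.Integer.Tactic.RingSolver as ℤ-Ring
open import Data.Sum using (inj₁; inj₂; _⊎_)
open import Data.Product using (_,_)
open import Data.Bool using (true; false)
open import Data.Empty using (⊥-elim)
open import Relation.Nullary.Reflects using (ofʸ; ofⁿ)
open import Relation.Binary.PropositionalEquality

-- The function f is a four-way case split on the inputs (a, b):
--   * b < a            : (b·⌊a/b⌋, b)         -- round a down to a multiple of b;
--   * a ≤ b, a² ≤ b    : (a, a·⌊b/a⌋)         -- round b down to a multiple of a;
--   * a ≤ b < a², (b − a)² < b : (a, a)       -- b is already close to a;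
--   * a ≤ b < a², (b − a)² ≥ b : (m, k·m)     -- k = ⌈b/a⌉, m = ⌊b/k⌋.
-- The first two cases rest on one fact about rounding n ≥ d down to a
-- multiple x of d: then n/2 < x ≤ n and n − x < d (RoundDown).  The last
-- case rounds b down to a multiple of k ≤ a, which keeps the gap below
-- k ≤ √b; the remaining point, a/2 < m, amounts to the arithmetic
-- inequality (1 + ⌊a/2⌋)·⌈b/a⌉ ≤ b, which holds because the hypothesis
-- (b − a)² ≥ b forces b ≥ a + 2 and a ≥ 3 (half-ceiling-bound).
-- Condition (iv) always follows because a′ ≥ b′ exactly when a ≥ b.

natural-difference : ∀ m n → n ≤ m → + m - + n ≡ + (m ∸ n)
natural-difference m n n≤m = trans (ℤP.[+m]-[+n]≡m⊖n m n) (ℤP.⊖-≥ n≤m)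

same-sign-≥ : ∀ x y x′ y′ → y ≤ x → y′ ≤ x′ → 0ℤ ≤ℤ ((+ x - + y) *ℤ (+ x′ - + y′))
same-sign-≥ x y x′ y′ y≤x y′≤x′
  rewrite natural-difference x y y≤x | natural-difference x′ y′ y′≤x′ =
  subst (0ℤ ≤ℤ_) (ℤP.pos-* (x ∸ y) (x′ ∸ y′)) (+≤+ z≤n)

swap-differences : ∀ (i j k l : ℤ) → (j - i) *ℤ (l - k) ≡ (i - j) *ℤ (k - l)
swap-differences = ℤ-Ring.solve-∀

same-sign-≤ : ∀ x y x′ y′ → x ≤ y → x′ ≤ y′ → 0ℤ ≤ℤ ((+ x - + y) *ℤ (+ x′ - + y′))
same-sign-≤ x y x′ y′ x≤y x′≤y′ =
  subst (0ℤ ≤ℤ_) (swap-differences (+ x) (+ y) (+ x′) (+ y′)) (same-sign-≥ y x y′ x′ x≤y x′≤y′)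

record RoundDown (n d x : ℕ) : Set where
  field
    multiple : d ∣ x
    atLeast  : d ≤ x
    atMost   : x ≤ n
    half     : n < 2 * x
    gap      : n ∸ x < d

double : ∀ x → x + x ≡ 2 * x
double x = cong (_+_ x) (sym (+-identityʳ x))

roundDown : ∀ n d → 1 ≤ d → d ≤ n → RoundDown n d (d * (n ÷ d))
roundDown n (suc d₀) _ d≤n = record
  { multiple = m∣m*n q
  ; atLeast  = d≤dq
  ; atMost   = subst (_≤ n) (*-comm q d) (m/n*n≤m n d)
  ; half     = begin-strict
      n             ≡⟨ m≡m%n+[m/n]*n n d ⟩
      n % d + q * d <⟨ +-monoˡ-< (q * d) (m%n<n n d) ⟩
      d + q * d     ≤⟨ +-mono-≤ d≤dq (≤-reflexive (*-comm q d)) ⟩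
      d * q + d * q ≡⟨ double (d * q) ⟩
      2 * (d * q)   ∎
  ; gap      = subst (_< d) (trans (m%n≡m∸m/n*n n d) (cong (n ∸_) (*-comm q d))) (m%n<n n d)
  }
  where
    open ≤-Reasoning
    d = suc d₀
    q = n / d
    d≤dq : d ≤ d * q
    d≤dq = subst (_≤ d * q) (*-identityʳ d) (*-monoʳ-≤ d (m≥n⇒m/n>0 d≤n))

self<double : ∀ n → 1 ≤ n → n < 2 * n
self<double n 1≤n = subst (n <_) (double n) (m<m+n n 1≤n)

zero-gap : ∀ n → 1 ≤ n → (n ∸ n) * (n ∸ n) < n
zero-gap n 1≤n = subst (λ z → z * z < n) (sym (n∸n≡0 n)) 1≤n

ceilDiv : ℕ → ℕ → ℕ
ceilDiv b a = 1 + (b ∸ 1) ÷ a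

ceiling-bounds : ∀ a b → 1 ≤ a → 1 ≤ b → ((b ∸ 1) ÷ a) * a < b × b ≤ ceilDiv b a * a
ceiling-bounds a@(suc _) (suc b₀) _ _ =
    s≤s (m/n*n≤m b₀ a)
  , subst (_≤ a + (b₀ / a) * a) (cong suc (sym (m≡m%n+[m/n]*n b₀ a)))
          (+-monoˡ-≤ ((b₀ / a) * a) (m%n<n b₀ a))

below-double-half : ∀ a → a < 2 * (1 + a ÷ 2)
below-double-half a = begin-strict
    a                 ≡⟨ m≡m%n+[m/n]*n a 2 ⟩
    a % 2 + a / 2 * 2 <⟨ +-monoˡ-< (a / 2 * 2) (m%n<n a 2) ⟩
    2 + a / 2 * 2     ≡⟨ two-times-succ (a / 2) ⟩
    2 * (1 + a / 2)   ∎
  where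
    open ≤-Reasoning
    two-times-succ : ∀ x → 2 + x * 2 ≡ 2 * (1 + x)
    two-times-succ = ℕ-Ring.solve-∀

gap-at-least-two : ∀ a b → 1 ≤ a → a ≤ b → b ≤ (b ∸ a) * (b ∸ a) → 2 + a ≤ b
gap-at-least-two a b 1≤a a≤b b≤gap² =
  subst (2 + a ≤_) d+a≡b (gap≥2 (b ∸ a) 1≤a (subst (_≤ (b ∸ a) * (b ∸ a)) (sym d+a≡b) b≤gap²))
  where
    d+a≡b : (b ∸ a) + a ≡ b
    d+a≡b = m∸n+n≡m a≤b
    gap≥2 : ∀ d → 1 ≤ a → d + a ≤ d * d → 2 + a ≤ d + a
    gap≥2 (suc (suc _)) _ _ = +-monoˡ-≤ a (s≤s (s≤s z≤n))
    gap≥2 zero 1≤a a≤0 = ⊥-elim (<⇒≱ 1≤a a≤0)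
    gap≥2 (suc zero) 1≤a 1+a≤1 = ⊥-elim (<⇒≱ 1≤a (s≤s⁻¹ 1+a≤1))

three-≤ : ∀ a b → 2 + a ≤ b → b < a * a → 3 ≤ a
three-≤ (suc (suc (suc _))) _ _ _ = s≤s (s≤s (s≤s z≤n))
three-≤ 0 _ _ ()
three-≤ 1 _ a+2≤b b<1 = ⊥-elim (<⇒≱ b<1 (≤-trans (s≤s z≤n) a+2≤b))
three-≤ 2 _ a+2≤b b<4 = ⊥-elim (<⇒≱ b<4 a+2≤b)

-- Write a = e + 2p, b = 1 + r + j·a, p = 1 + p′, j = 1 + j′.  Then
--   (2 + p′)(2 + j′) + (r + e·(1 + j′) + p′·j′)  =  1 + b,
-- so (1 + p)(1 + j) ≤ b as soon as the slack r + e(1 + j′) + p′j′ is positive.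
slack-identity : ∀ p′ j′ e r → (2 + p′) * (2 + j′) + (r + e * (1 + j′) + p′ * j′)
                             ≡ 2 + (r + (1 + j′) * (e + (1 + p′) * 2))
slack-identity = ℕ-Ring.solve-∀

slack-positive : ∀ e p′ j′ r → 1 ≤ r ⊎ 1 ≤ j′ → e ≡ 1 ⊎ 1 ≤ p′ → 1 ≤ r + e * suc j′ + p′ * j′
slack-positive e p′ j′ (suc r) _ _ = s≤s z≤n
slack-positive e p′ j′ zero (inj₁ ()) _
slack-positive e p′ zero zero (inj₂ ()) _
slack-positive e p′ (suc j′) zero (inj₂ _) (inj₁ refl) = s≤s z≤n
slack-positive e (suc p′) (suc j′) zero (inj₂ _) (inj₂ _) =
  ≤-trans (s≤s z≤n) (m≤n+m (suc p′ * suc j′) (e * suc (suc j′)))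
slack-positive e zero (suc j′) zero (inj₂ _) (inj₂ ())

product-bound : ∀ e p′ j′ r → 1 ≤ r ⊎ 1 ≤ j′ → e ≡ 1 ⊎ 1 ≤ p′
              → (2 + p′) * (2 + j′) ≤ suc (r + (1 + j′) * (e + (1 + p′) * 2))
product-bound e p′ j′ r r-or-j′ e-or-p′ = s≤s⁻¹ (begin
    suc ((2 + p′) * (2 + j′))     ≡⟨ +-comm 1 _ ⟩
    (2 + p′) * (2 + j′) + 1       ≤⟨ +-monoʳ-≤ _ (slack-positive e p′ j′ r r-or-j′ e-or-p′) ⟩
    (2 + p′) * (2 + j′) + (r + e * (1 + j′) + p′ * j′) ≡⟨ slack-identity p′ j′ e r ⟩
    2 + (r + (1 + j′) * (e + (1 + p′) * 2)) ∎)
  where open ≤-Reasoning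

remainder-or-quotient : ∀ a r j′ → 2 + a ≤ suc (r + suc j′ * a) → 1 ≤ r ⊎ 1 ≤ j′
remainder-or-quotient a (suc r) j′ _ = inj₁ (s≤s z≤n)
remainder-or-quotient a zero (suc j′) _ = inj₂ (s≤s z≤n)
remainder-or-quotient a zero zero a+2≤a+1 =
  ⊥-elim (n≮n a (subst (a <_) (+-identityʳ a) (s≤s⁻¹ a+2≤a+1)))

odd-or-large : ∀ e p′ → e < 2 → 3 ≤ e + suc p′ * 2 → e ≡ 1 ⊎ 1 ≤ p′
odd-or-large 0 0 _ (s≤s (s≤s ()))
odd-or-large 0 (suc p′) _ _ = inj₂ (s≤s z≤n)
odd-or-large 1 p′ _ _ = inj₁ refl
odd-or-large (suc (suc e)) p′ (s≤s (s≤s ())) _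

decomposed-bound : ∀ {a b} e p j r → e < 2 → r < a → a ≡ e + p * 2 → b ≡ suc (r + j * a)
                 → 3 ≤ a → 2 + a ≤ b → suc p * suc j ≤ b
decomposed-bound e zero j r e<2 _ refl _ 3≤a _ =
  ⊥-elim (<⇒≱ e<2 (≤-trans (n≤1+n 2) (subst (3 ≤_) (+-identityʳ e) 3≤a)))
decomposed-bound e (suc p) zero r _ r<a refl refl _ a+2≤b =
  ⊥-elim (<⇒≱ r<a (≤-trans (n≤1+n a) (s≤s⁻¹ (subst (2 + a ≤_) (cong suc (+-identityʳ r)) a+2≤b))))
  where
    a : ℕ
    a = e + suc p * 2
decomposed-bound e (suc p′) (suc j′) r e<2 _ refl refl 3≤a a+2≤b =
  product-bound e p′ j′ r (remainder-or-quotient _ r j′ a+2≤b) (odd-or-large e p′ e<2 3≤a)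

half-ceiling-bound : ∀ a b → 3 ≤ a → 2 + a ≤ b → (1 + a ÷ 2) * ceilDiv b a ≤ b
half-ceiling-bound a@(suc _) (suc b₀) 3≤a a+2≤b =
  decomposed-bound (a % 2) (a / 2) (b₀ / a) (b₀ % a) (m%n<n a 2) (m%n<n b₀ a)
                   (m≡m%n+[m/n]*n a 2) (cong suc (m≡m%n+[m/n]*n b₀ a)) 3≤a a+2≤b

larger-first : ∀ a b → 1 ≤ b → b < a → Props a b (b * (a ÷ b)) b
larger-first a b 1≤b b<a =
    inj₂ multiple
  , (half , atMost)
  , ((self<double b 1≤b , zero-gap b 1≤b) , ≤-refl)
  , same-sign-≥ a b (b * (a ÷ b)) b (<⇒≤ b<a) atLeast
  where open RoundDown (roundDown a b 1≤b (<⇒≤ b<a))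

-- a ≤ b and a² ≤ b: round b down to a multiple of a; the gap is below a ≤ √b.
square-below : ∀ a b → 1 ≤ a → a ≤ b → a * a ≤ b → Props a b a (a * (b ÷ a))
square-below a b 1≤a a≤b a²≤b =
    inj₁ multiple
  , (self<double a 1≤a , ≤-refl)
  , ((half , <-≤-trans (*-mono-< gap gap) a²≤b) , atMost)
  , same-sign-≤ a b a (a * (b ÷ a)) a≤b atLeast
  where open RoundDown (roundDown b a 1≤a a≤b)

close-pair : ∀ a b → 1 ≤ a → a ≤ b → b < a * a → (b ∸ a) * (b ∸ a) < b → Props a b a a
close-pair a b 1≤a a≤b b<a² gap²<b =
    inj₁ ∣-refl
  , (self<double a 1≤a , ≤-refl)
  , ((b<2a , gap²<b) , a≤b)
  , same-sign-≤ a b a a a≤b ≤-refl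
  where
    d : ℕ
    d = b ∸ a
    d<a : d < a
    d<a = ≰⇒> (λ a≤d → <⇒≱ (<-trans gap²<b b<a²) (*-mono-≤ a≤d a≤d))
    b<2a : b < 2 * a
    b<2a = subst₂ _<_ (m∸n+n≡m a≤b) (double a) (+-monoˡ-< a d<a)

-- a ≤ b < a² and (b − a)² ≥ b: with k = ⌈b/a⌉ ≤ a, round b down to a
-- multiple k·m of k; the gap is below k, and (k − 1)² ≤ (k − 1)·a < b.
far-pair : ∀ a b → 1 ≤ a → a ≤ b → b < a * a → b ≤ (b ∸ a) * (b ∸ a)
         → Props a b (b ÷ ceilDiv b a) (ceilDiv b a * (b ÷ ceilDiv b a))
far-pair a b 1≤a a≤b b<a² b≤gap² =
    inj₁ (n∣m*n k)
  , (a<2m , m≤a)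
  , ((half , gap²<b) , atMost)
  , same-sign-≤ a b m (k * m) a≤b (m≤n*m m k)
  where
    j k m : ℕ
    j = (b ∸ 1) ÷ a
    k = ceilDiv b a
    m = b ÷ k
    bounds : j * a < b × b ≤ k * a
    bounds = ceiling-bounds a b 1≤a (≤-trans 1≤a a≤b)
    j<a : j < a
    j<a = *-cancelʳ-< a j a (<-trans (proj₁ bounds) b<a²)
    open RoundDown (roundDown b k (s≤s z≤n) (≤-trans j<a a≤b))
    m≤a : m ≤ a
    m≤a = *-cancelˡ-≤ k (≤-trans atMost (proj₂ bounds))
    gap²<b : (b ∸ k * m) * (b ∸ k * m) < b
    gap²<b = ≤-<-trans (*-mono-≤ (s≤s⁻¹ gap) (s≤s⁻¹ gap))
               (≤-<-trans (*-monoʳ-≤ j (<⇒≤ j<a)) (proj₁ bounds))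
    a+2≤b : 2 + a ≤ b
    a+2≤b = gap-at-least-two a b 1≤a a≤b b≤gap²
    h≤m : 1 + a ÷ 2 ≤ m
    h≤m = subst (_≤ m) (m*n/n≡m (1 + a ÷ 2) k)
            (/-monoˡ-≤ k (half-ceiling-bound a b (three-≤ a b a+2≤b b<a²) a+2≤b))
    a<2m : a < 2 * m
    a<2m = <-≤-trans (below-double-half a) (*-monoʳ-≤ 2 h≤m)

ceilExpr cofactorExpr gapExpr : Expr
ceilExpr     = const 1 ⊕ ((varB ⊖ const 1) ⊘ varA)
cofactorExpr = varB ⊘ ceilExpr
gapExpr      = ((varB ⊖ varA) ⊗ (varB ⊖ varA)) ⊕ const 1

firstExpr secondExpr : Expr
firstExpr  = ifLe varA varB (ifLe (varA ⊗ varA) varB varA (ifLe gapExpr varB varA cofactorExpr))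
                            (varB ⊗ (varA ⊘ varB))
secondExpr = ifLe varA varB (ifLe (varA ⊗ varA) varB (varA ⊗ (varB ⊘ varA))
                                  (ifLe gapExpr varB varA (ceilExpr ⊗ cofactorExpr)))
                            varB

f : ℕ → ℕ → ℕ × ℕ
f a b = eval firstExpr a b , eval secondExpr a b

f-props : ∀ a b → 1 ≤ a → 1 ≤ b → Props a b (proj₁ (f a b)) (proj₂ (f a b))
f-props a b 1≤a 1≤b with a ≤ᵇ b | ≤ᵇ-reflects-≤ a b
... | false | ofⁿ a≰b = larger-first a b 1≤b (≰⇒> a≰b)
... | true  | ofʸ a≤b with a * a ≤ᵇ b | ≤ᵇ-reflects-≤ (a * a) b
...   | true  | ofʸ a²≤b = square-below a b 1≤a a≤b a²≤b
...   | false | ofⁿ a²≰b with (b ∸ a) * (b ∸ a) + 1 ≤ᵇ b | ≤ᵇ-reflects-≤ ((b ∸ a) * (b ∸ a) + 1) b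
...     | true  | ofʸ close = close-pair a b 1≤a a≤b (≰⇒> a²≰b) (subst (_≤ b) (+-comm _ 1) close)
...     | false | ofⁿ far   = far-pair a b 1≤a a≤b (≰⇒> a²≰b)
                                (s≤s⁻¹ (subst (b <_) (+-comm _ 1) (≰⇒> far)))

lemma1 : Σ (ℕ → ℕ → ℕ × ℕ) λ f → ConstantTime f ×
    (∀ a b → 1 ≤ a → 1 ≤ b → Props a b (proj₁ (f a b)) (proj₂ (f a b)))
lemma1 = f , (firstExpr , secondExpr , λ _ _ _ _ → refl) , f-props
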